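{- The optimum cost of the PFCT-S instance, i.e. $\min_{x\in\mathcal{X}}\sum_{i\in S,j\in T}\mathbf{1}_{x_{ij}>0}f_i$, is at least $\sum_{i=1}^n(f_i-f_{i+1})\,\pi(a([i]))$.
   Context: A PFCT-S instance: sources $S=[n]$ with supplies $a_i\in\mathbb{Z}_{>0}$ and costs $f_i\ge0$ ordered so that $f_1\ge\cdots\ge f_n$; sinks $T=[m]$ with demands $b_j\in\mathbb{Z}_{>0}$ ordered so that $b_1\ge\cdots\ge b_m$; $\sum_i a_i=\sum_j b_j$. $\mathcal{X}=\{x\in\mathbb{R}_{\ge0}^{S\times T}:\sum_{j}x_{ij}=a_i\ \forall i,\ \sum_i x_{ij}=b_j\ \forall j\}$. For $U$ a set of indices, $a(U)=\sum_{i\in U}a_i$, $b(U)=\sum_{j\in U}b_j$. Set $f_{n+1}=0$. For real $t\in(0,b([m])]$, $\pi(t)$ is the smallest $j$ with $b([j])\ge t$.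
   Formalization: The costs $f_i$ are rational, and the feasible plans range only over the rational points of $\mathcal{X}$ rather than all of its real points. -}

module Defs where

open import Data.Nat as ℕ using (ℕ; zero; suc; _≤ᵇ_)
open import Data.Fin as Fin using (Fin; toℕ; fromℕ<)
open import Data.Bool using (if_then_else_)
open import Data.Integer using (+_)
open import Data.Rational as ℚ using (ℚ; 0ℚ; _+_; _-_; _*_; _<_; _≤_)
open import Data.Rational.Properties using (_<?_)
open import Relation.Nullary using (does; yes; no)

sumℕ : ∀ {k} → (Fin k → ℕ) → ℕ
sumℕ {zero}  g = 0
sumℕ {suc k} g = g Fin.zero ℕ.+ sumℕ (λ j → g (Fin.suc j))

sumℚ : ∀ {k} → (Fin k → ℚ) → ℚ
sumℚ {zero}  g = 0ℚ
sumℚ {suc k} g = g Fin.zero + sumℚ (λ j → g (Fin.suc j))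

ℕ→ℚ : ℕ → ℚ
ℕ→ℚ k = (+ k) ℚ./ 1

-- prefix sum with 1-based convention: prefix c k = c_1 + ... + c_k
-- (index j : Fin p stands for the paper's index toℕ j + 1)
prefix : ∀ {p} → (Fin p → ℕ) → ℕ → ℕ
prefix c k = sumℕ (λ j → if (suc (toℕ j) ≤ᵇ k) then c j else 0)

-- π(t): the smallest j ∈ {1,…,m} with b([j]) ≥ t  (search j = 1,2,…,m;
-- returns m+1 if none exists, which never happens for t ∈ (0, b([m])])
piAux : ∀ {m} → (Fin m → ℕ) → ℕ → (fuel j : ℕ) → ℕ
piAux b t zero       j = j
piAux b t (suc fuel) j = if (t ≤ᵇ prefix b j) then j else piAux b t fuel (suc j)

π : ∀ {m} → (Fin m → ℕ) → ℕ → ℕ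
π {m} b t = piAux b t m 1

-- f extended by f_{k} for 0-based index k, with value 0 beyond the end
-- (so fExt f n is the paper's f_{n+1} = 0)
fExt : ∀ {n} → (Fin n → ℚ) → ℕ → ℚ
fExt {n} f k with k ℕ.<? n
... | yes k<n = f (fromℕ< k<n)
... | no  _   = 0ℚ

Feasible : ∀ {n m} → (Fin n → ℕ) → (Fin m → ℕ) → (Fin n → Fin m → ℚ) → Set
Feasible {n} {m} a b x =
  (∀ i j → 0ℚ ≤ x i j) Data.Product.×
  ((∀ i → sumℚ (λ j → x i j) ≡ ℕ→ℚ (a i)) Data.Product.×
   (∀ j → sumℚ (λ i → x i j) ≡ ℕ→ℚ (b j)))
  where open import Data.Product
        open import Relation.Binary.PropositionalEquality using (_≡_)

cost : ∀ {n m} → (Fin n → ℚ) → (Fin n → Fin m → ℚ) → ℚ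
cost f x = sumℚ (λ i → sumℚ (λ j → if does (0ℚ <? x i j) then f i else 0ℚ))

lowerBound : ∀ {n m} → (Fin n → ℕ) → (Fin m → ℕ) → (Fin n → ℚ) → ℚ
lowerBound a b f =
  sumℚ (λ i → (f i - fExt f (suc (toℕ i))) * ℕ→ℚ (π b (prefix a (suc (toℕ i)))))

{-# OPTIONS --safe #-}
module Submission where

open import Defs
open import Data.Nat using (ℕ; _>_)
open import Data.Fin using (Fin)
open import Data.Product using (_×_)
open import Data.Rational using (ℚ; 0ℚ; _≤_)
open import Relation.Binary.PropositionalEquality using (_≡_)

open import Data.Bool using (Bool; true; false; if_then_else_; _∧_; _∨_; T)
open import Data.Bool.Properties using (T-≡; ∨-zeroʳ)
open import Data.Empty using (⊥-elim)
open import Data.Fin as Fin using (zero; suc; toℕ; fromℕ<)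
import Data.Fin.Properties as Finₚ
import Data.Integer as ℤ
import Data.Integer.Properties as ℤₚ
open import Data.Nat as ℕ using (zero; suc)
import Data.Nat.Coprimality as Coprimality
import Data.Nat.Properties as ℕₚ
open import Data.Product using (_,_)
open import Data.Rational using (mkℚ; *≤*; _+_; _-_; _*_; -_; nonNegative)
open import Data.Rational.Properties using (_<?_)
import Data.Rational.Properties as ℚₚ
open import Data.Rational.Solver using (module +-*-Solver)
open import Function using (_∘_; Equivalence)
open import Relation.Binary.PropositionalEquality
  using (refl; sym; trans; cong; cong₂; subst; subst₂; module ≡-Reasoning)
open import Relation.Nullary using (does; yes; no; contradiction)

-- Let d i be the number of positive entries in row i of x, so that cost f x = Σ f_i d_i; by
-- summation by parts (with f_{n+1} = 0) this is Σ_i (f_i − f_{i+1}) (d_1 + ⋯ + d_i), and the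
-- coefficients f_i − f_{i+1} are nonnegative.  So it suffices that π(a([i])) ≤ d_1 + ⋯ + d_i.
-- The first i rows touch at most d_1 + ⋯ + d_i columns, and these columns must absorb the
-- mass a([i]); as b is decreasing, c columns absorb at most b([c]).

ℕ→ℚ-mkℚ : ∀ k → ℕ→ℚ k ≡ mkℚ (ℤ.+ k) 0 (Coprimality.sym (Coprimality.1-coprimeTo k))
ℕ→ℚ-mkℚ k = ℚₚ.↥p/↧p≡p (mkℚ (ℤ.+ k) 0 _)

ℕ→ℚ-homo-+ : ∀ k l → ℕ→ℚ (k ℕ.+ l) ≡ ℕ→ℚ k + ℕ→ℚ l
ℕ→ℚ-homo-+ k l rewrite ℕ→ℚ-mkℚ k | ℕ→ℚ-mkℚ l
                     | ℤₚ.*-identityʳ (ℤ.+ k) | ℤₚ.*-identityʳ (ℤ.+ l) = refl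

ℕ→ℚ-mono-≤ : ∀ {k l} → k ℕ.≤ l → ℕ→ℚ k ≤ ℕ→ℚ l
ℕ→ℚ-mono-≤ {k} {l} k≤l rewrite ℕ→ℚ-mkℚ k | ℕ→ℚ-mkℚ l =
  *≤* (subst₂ ℤ._≤_ (sym (ℤₚ.*-identityʳ (ℤ.+ k))) (sym (ℤₚ.*-identityʳ (ℤ.+ l))) (ℤ.+≤+ k≤l))

ℕ→ℚ-cancel-≤ : ∀ {k l} → ℕ→ℚ k ≤ ℕ→ℚ l → k ℕ.≤ l
ℕ→ℚ-cancel-≤ {k} {l} k≤l rewrite ℕ→ℚ-mkℚ k | ℕ→ℚ-mkℚ l with ℚₚ.drop-*≤* k≤l
... | k*1≤l*1 rewrite ℤₚ.*-identityʳ (ℤ.+ k) | ℤₚ.*-identityʳ (ℤ.+ l) = ℤₚ.drop‿+≤+ k*1≤l*1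

ℕ→ℚ-if : ∀ c k → ℕ→ℚ (if c then k else 0) ≡ (if c then ℕ→ℚ k else 0ℚ)
ℕ→ℚ-if true  k = refl
ℕ→ℚ-if false k = refl

p≤q⇒0≤q-p : ∀ {p q} → p ≤ q → 0ℚ ≤ q - p
p≤q⇒0≤q-p {p} p≤q = ℚₚ.≤-trans (ℚₚ.≤-reflexive (sym (ℚₚ.+-inverseʳ p))) (ℚₚ.+-monoˡ-≤ (- p) p≤q)

sumℕ-zero : ∀ {k} → sumℕ {k} (λ _ → 0) ≡ 0
sumℕ-zero {zero}  = refl
sumℕ-zero {suc k} = sumℕ-zero {k}

sumℕ-cong : ∀ {k} {g h : Fin k → ℕ} → (∀ i → g i ≡ h i) → sumℕ g ≡ sumℕ h
sumℕ-cong {zero}  g≡h = refl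
sumℕ-cong {suc k} g≡h = cong₂ ℕ._+_ (g≡h zero) (sumℕ-cong (g≡h ∘ suc))

single≤sumℕ : ∀ {k} (g : Fin k → ℕ) i → g i ℕ.≤ sumℕ g
single≤sumℕ g zero    = ℕₚ.m≤m+n _ _
single≤sumℕ g (suc i) = ℕₚ.≤-trans (single≤sumℕ (g ∘ suc) i) (ℕₚ.m≤n+m _ _)

sumℚ-zero : ∀ {k} → sumℚ {k} (λ _ → 0ℚ) ≡ 0ℚ
sumℚ-zero {zero}  = refl
sumℚ-zero {suc k} = cong (0ℚ +_) (sumℚ-zero {k})

sumℚ-cong : ∀ {k} {g h : Fin k → ℚ} → (∀ i → g i ≡ h i) → sumℚ g ≡ sumℚ h
sumℚ-cong {zero}  g≡h = refl
sumℚ-cong {suc k} g≡h = cong₂ _+_ (g≡h zero) (sumℚ-cong (g≡h ∘ suc))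

sumℚ-mono-≤ : ∀ {k} {g h : Fin k → ℚ} → (∀ i → g i ≤ h i) → sumℚ g ≤ sumℚ h
sumℚ-mono-≤ {zero}  g≤h = ℚₚ.≤-refl
sumℚ-mono-≤ {suc k} g≤h = ℚₚ.+-mono-≤ (g≤h zero) (sumℚ-mono-≤ (g≤h ∘ suc))

sumℚ-distrib-+ : ∀ {k} (g h : Fin k → ℚ) → sumℚ (λ i → g i + h i) ≡ sumℚ g + sumℚ h
sumℚ-distrib-+ {zero}  g h = refl
sumℚ-distrib-+ {suc k} g h = begin
  (g zero + h zero) + sumℚ (λ i → g (suc i) + h (suc i))
    ≡⟨ cong ((g zero + h zero) +_) (sumℚ-distrib-+ (g ∘ suc) (h ∘ suc)) ⟩
  (g zero + h zero) + (sumℚ (g ∘ suc) + sumℚ (h ∘ suc))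
    ≡⟨ interchange (g zero) (h zero) (sumℚ (g ∘ suc)) (sumℚ (h ∘ suc)) ⟩
  (g zero + sumℚ (g ∘ suc)) + (h zero + sumℚ (h ∘ suc)) ∎
  where
  open ≡-Reasoning
  open +-*-Solver
  interchange : ∀ p q r s → (p + q) + (r + s) ≡ (p + r) + (q + s)
  interchange = solve 4 (λ p q r s → (p :+ q) :+ (r :+ s) := (p :+ r) :+ (q :+ s)) refl

sumℚ-comm : ∀ {k l} (x : Fin k → Fin l → ℚ) →
  sumℚ (λ i → sumℚ (λ j → x i j)) ≡ sumℚ (λ j → sumℚ (λ i → x i j))
sumℚ-comm {zero}  {l} x = sym (sumℚ-zero {l})
sumℚ-comm {suc k} {l} x =
  trans (cong (sumℚ (x zero) +_) (sumℚ-comm (x ∘ suc)))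
        (sym (sumℚ-distrib-+ (x zero) (λ j → sumℚ (λ i → x (suc i) j))))

sumℚ-if : ∀ {k} c (g : Fin k → ℚ) →
  sumℚ (λ i → if c then g i else 0ℚ) ≡ (if c then sumℚ g else 0ℚ)
sumℚ-if     true  g = refl
sumℚ-if {k} false g = sumℚ-zero {k}

*-distribˡ-sumℚ : ∀ {k} p (g : Fin k → ℚ) → p * sumℚ g ≡ sumℚ (λ i → p * g i)
*-distribˡ-sumℚ {zero}  p g = ℚₚ.*-zeroʳ p
*-distribˡ-sumℚ {suc k} p g =
  trans (ℚₚ.*-distribˡ-+ p (g zero) (sumℚ (g ∘ suc)))
        (cong (p * g zero +_) (*-distribˡ-sumℚ p (g ∘ suc)))

ℕ→ℚ-sumℕ : ∀ {k} (g : Fin k → ℕ) → ℕ→ℚ (sumℕ g) ≡ sumℚ (λ i → ℕ→ℚ (g i))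
ℕ→ℚ-sumℕ {zero}  g = refl
ℕ→ℚ-sumℕ {suc k} g =
  trans (ℕ→ℚ-homo-+ (g zero) (sumℕ (g ∘ suc))) (cong (ℕ→ℚ (g zero) +_) (ℕ→ℚ-sumℕ (g ∘ suc)))

ℕ→ℚ-selectedSum : ∀ {k} (s : Fin k → Bool) (g : Fin k → ℕ) (h : Fin k → ℚ) →
  (∀ i → ℕ→ℚ (g i) ≡ h i) →
  ℕ→ℚ (sumℕ (λ i → if s i then g i else 0)) ≡ sumℚ (λ i → if s i then h i else 0ℚ)
ℕ→ℚ-selectedSum s g h g≡h = trans (ℕ→ℚ-sumℕ (λ i → if s i then g i else 0)) (sumℚ-cong λ i →
  trans (ℕ→ℚ-if (s i) (g i)) (cong (λ q → if s i then q else 0ℚ) (g≡h i)))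

count : ∀ {k} → (Fin k → Bool) → ℕ
count s = sumℕ (λ i → if s i then 1 else 0)

count≤ : ∀ {k} (s : Fin k → Bool) → count s ℕ.≤ k
count≤ {zero}  s = ℕ.z≤n
count≤ {suc k} s with s zero
... | true  = ℕ.s≤s (count≤ (s ∘ suc))
... | false = ℕₚ.m≤n⇒m≤1+n (count≤ (s ∘ suc))

count-∨ : ∀ {k} (u v : Fin k → Bool) → count (λ i → u i ∨ v i) ℕ.≤ count u ℕ.+ count v
count-∨ {zero}  u v = ℕ.z≤n
count-∨ {suc k} u v with u zero | v zero
... | true  | v₀    = ℕ.s≤s (ℕₚ.≤-trans (count-∨ (u ∘ suc) (v ∘ suc))
                        (ℕₚ.+-monoʳ-≤ (count (u ∘ suc)) (ℕₚ.m≤n+m _ (if v₀ then 1 else 0))))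
... | false | true  = ℕₚ.≤-trans (ℕ.s≤s (count-∨ (u ∘ suc) (v ∘ suc)))
                        (ℕₚ.≤-reflexive (sym (ℕₚ.+-suc _ _)))
... | false | false = count-∨ (u ∘ suc) (v ∘ suc)

count-∧ : ∀ {k} c (s : Fin k → Bool) → count (λ i → c ∧ s i) ≡ (if c then count s else 0)
count-∧     true  s = refl
count-∧ {k} false s = sumℕ-zero {k}

sumℚ-indicator : ∀ {k} (s : Fin k → Bool) p →
  sumℚ (λ i → if s i then p else 0ℚ) ≡ p * ℕ→ℚ (count s)
sumℚ-indicator s p = begin
  sumℚ (λ i → if s i then p else 0ℚ)       ≡⟨ sumℚ-cong (λ i → if≡*indicator (s i)) ⟩
  sumℚ (λ i → p * ℕ→ℚ (indicator i))       ≡⟨ *-distribˡ-sumℚ p (ℕ→ℚ ∘ indicator) ⟨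
  p * sumℚ (λ i → ℕ→ℚ (indicator i))       ≡⟨ cong (p *_) (ℕ→ℚ-sumℕ indicator) ⟨
  p * ℕ→ℚ (count s)                        ∎
  where
  open ≡-Reasoning
  indicator : Fin _ → ℕ
  indicator i = if s i then 1 else 0
  if≡*indicator : ∀ c → (if c then p else 0ℚ) ≡ p * ℕ→ℚ (if c then 1 else 0)
  if≡*indicator true  = sym (ℚₚ.*-identityʳ p)
  if≡*indicator false = sym (ℚₚ.*-zeroʳ p)

anyFin : ∀ {k} → (Fin k → Bool) → Bool
anyFin {zero}  s = false
anyFin {suc k} s = s zero ∨ anyFin (s ∘ suc)

anyFin-intro : ∀ {k} (s : Fin k → Bool) i → s i ≡ true → anyFin s ≡ true
anyFin-intro s zero    sᵢ rewrite sᵢ = refl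
anyFin-intro s (suc i) sᵢ rewrite anyFin-intro (s ∘ suc) i sᵢ = ∨-zeroʳ (s zero)

count-anyFin≤ : ∀ {k l} (P : Fin k → Fin l → Bool) →
  count (λ j → anyFin (λ i → P i j)) ℕ.≤ sumℕ (λ i → count (P i))
count-anyFin≤ {zero}  {l} P = ℕₚ.≤-reflexive (sumℕ-zero {l})
count-anyFin≤ {suc k}     P =
  ℕₚ.≤-trans (count-∨ (P zero) (λ j → anyFin (λ i → P (suc i) j)))
             (ℕₚ.+-monoʳ-≤ (count (P zero)) (count-anyFin≤ (P ∘ suc)))

fExt-toℕ : ∀ {n} (f : Fin n → ℚ) i → fExt f (toℕ i) ≡ f i
fExt-toℕ {n} f i with toℕ i ℕ.<? n
... | yes i<n = cong f (Finₚ.fromℕ<-toℕ i i<n)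
... | no  i≮n = contradiction (Finₚ.toℕ<n i) i≮n

fExt-end : ∀ {n} (f : Fin n → ℚ) → fExt f n ≡ 0ℚ
fExt-end {n} f with n ℕ.<? n
... | yes n<n = contradiction n<n (ℕₚ.<-irrefl refl)
... | no  _   = refl

fExt-suc≤ : ∀ {n} (f : Fin n → ℚ) → (∀ i → 0ℚ ≤ f i) → (∀ i i′ → i Fin.≤ i′ → f i′ ≤ f i) →
  ∀ i → fExt f (suc (toℕ i)) ≤ f i
fExt-suc≤ {n} f f≥0 f-anti i with suc (toℕ i) ℕ.<? n
... | yes i+1<n = f-anti i (fromℕ< i+1<n)
                    (ℕₚ.≤-trans (ℕₚ.n≤1+n _) (ℕₚ.≤-reflexive (sym (Finₚ.toℕ-fromℕ< i+1<n))))
... | no  _     = f≥0 i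

prefix-zero : ∀ {k} (d : Fin k → ℕ) → prefix d 0 ≡ 0
prefix-zero {k} d = sumℕ-zero {k}

-- The offset c accumulates the entries of d already peeled off, which makes the identity inductive.
summation-by-parts-from : ∀ {n} (G : ℕ → ℚ) (d : Fin n → ℕ) c → G n ≡ 0ℚ →
  sumℚ {n} (λ i → (G (toℕ i) - G (suc (toℕ i))) * ℕ→ℚ (c ℕ.+ prefix d (suc (toℕ i))))
  ≡ G 0 * ℕ→ℚ c + sumℚ (λ i → G (toℕ i) * ℕ→ℚ (d i))
summation-by-parts-from {zero}  G d c G₀≡0 rewrite G₀≡0 =
  sym (trans (ℚₚ.+-identityʳ (0ℚ * ℕ→ℚ c)) (ℚₚ.*-zeroˡ (ℕ→ℚ c)))
summation-by-parts-from {suc n} G d c Gₙ≡0 = begin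
  (G 0 - G 1) * ℕ→ℚ (c ℕ.+ prefix d 1) + Tail (λ i → c ℕ.+ prefix d (2 ℕ.+ toℕ i))
    ≡⟨ cong₂ (λ e t → (G 0 - G 1) * ℕ→ℚ (c ℕ.+ e) + t)
             (trans (cong (d zero ℕ.+_) (prefix-zero (d ∘ suc))) (ℕₚ.+-identityʳ (d zero)))
             (Tail-cong λ i → sym (ℕₚ.+-assoc c (d zero) (prefix (d ∘ suc) (suc (toℕ i))))) ⟩
  (G 0 - G 1) * ℕ→ℚ (c ℕ.+ d zero) + Tail (λ i → (c ℕ.+ d zero) ℕ.+ prefix (d ∘ suc) (suc (toℕ i)))
    ≡⟨ cong ((G 0 - G 1) * ℕ→ℚ (c ℕ.+ d zero) +_)
            (summation-by-parts-from (G ∘ suc) (d ∘ suc) (c ℕ.+ d zero) Gₙ≡0) ⟩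
  (G 0 - G 1) * ℕ→ℚ (c ℕ.+ d zero) + (G 1 * ℕ→ℚ (c ℕ.+ d zero) + S)
    ≡⟨ cong (λ e → (G 0 - G 1) * e + (G 1 * e + S)) (ℕ→ℚ-homo-+ c (d zero)) ⟩
  (G 0 - G 1) * (ℕ→ℚ c + ℕ→ℚ (d zero)) + (G 1 * (ℕ→ℚ c + ℕ→ℚ (d zero)) + S)
    ≡⟨ telescope (G 0) (G 1) (ℕ→ℚ c) (ℕ→ℚ (d zero)) S ⟩
  G 0 * ℕ→ℚ c + (G 0 * ℕ→ℚ (d zero) + S) ∎
  where
  open ≡-Reasoning
  open +-*-Solver
  Tail : (Fin n → ℕ) → ℚ
  Tail D = sumℚ (λ i → (G (suc (toℕ i)) - G (2 ℕ.+ toℕ i)) * ℕ→ℚ (D i))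
  Tail-cong : ∀ {D D′} → (∀ i → D i ≡ D′ i) → Tail D ≡ Tail D′
  Tail-cong D≡D′ = sumℚ-cong λ i → cong (λ e → (G (suc (toℕ i)) - G (2 ℕ.+ toℕ i)) * ℕ→ℚ e) (D≡D′ i)
  S : ℚ
  S = sumℚ (λ i → G (suc (toℕ i)) * ℕ→ℚ (d (suc i)))
  telescope : ∀ g₀ g₁ p q s → (g₀ - g₁) * (p + q) + (g₁ * (p + q) + s) ≡ g₀ * p + (g₀ * q + s)
  telescope = solve 5 (λ g₀ g₁ p q s →
    (g₀ :- g₁) :* (p :+ q) :+ (g₁ :* (p :+ q) :+ s) := g₀ :* p :+ (g₀ :* q :+ s)) refl

summation-by-parts : ∀ {n} (G : ℕ → ℚ) (d : Fin n → ℕ) → G n ≡ 0ℚ →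
  sumℚ {n} (λ i → (G (toℕ i) - G (suc (toℕ i))) * ℕ→ℚ (prefix d (suc (toℕ i))))
  ≡ sumℚ (λ i → G (toℕ i) * ℕ→ℚ (d i))
summation-by-parts G d Gₙ≡0 = begin
  _                  ≡⟨ summation-by-parts-from G d 0 Gₙ≡0 ⟩
  G 0 * 0ℚ + S       ≡⟨ cong (_+ S) (ℚₚ.*-zeroʳ (G 0)) ⟩
  0ℚ + S             ≡⟨ ℚₚ.+-identityˡ S ⟩
  S                  ∎
  where
  open ≡-Reasoning
  S : ℚ
  S = sumℚ (λ i → G (toℕ i) * ℕ→ℚ (d i))

Decreasing : ∀ {m} → (Fin m → ℕ) → Set
Decreasing b = ∀ j j′ → j Fin.≤ j′ → b j′ ℕ.≤ b j

Decreasing-tail : ∀ {m} {b : Fin (suc m) → ℕ} → Decreasing b → Decreasing (b ∘ suc)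
Decreasing-tail b-anti j j′ j≤j′ = b-anti (suc j) (suc j′) (ℕ.s≤s j≤j′)

prefix-tail≤prefix : ∀ {m} {b : Fin (suc m) → ℕ} → Decreasing b → ∀ c → prefix (b ∘ suc) c ℕ.≤ prefix b c
prefix-tail≤prefix {m} {b} b-anti zero =
  ℕₚ.≤-reflexive (trans (prefix-zero (b ∘ suc)) (sym (prefix-zero b)))
prefix-tail≤prefix {zero}  b-anti (suc c) = ℕ.z≤n
prefix-tail≤prefix {suc m} b-anti (suc c) =
  ℕₚ.+-mono-≤ (b-anti zero (suc zero) ℕ.z≤n) (prefix-tail≤prefix (Decreasing-tail b-anti) c)

selectedSum≤prefix-count : ∀ {m} {b : Fin m → ℕ} → Decreasing b → ∀ s →
  sumℕ (λ j → if s j then b j else 0) ℕ.≤ prefix b (count s)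
selectedSum≤prefix-count {zero}      b-anti s = ℕ.z≤n
selectedSum≤prefix-count {suc m} {b} b-anti s with s zero
... | true  = ℕₚ.+-monoʳ-≤ (b zero) (selectedSum≤prefix-count (Decreasing-tail b-anti) (s ∘ suc))
... | false = ℕₚ.≤-trans (selectedSum≤prefix-count (Decreasing-tail b-anti) (s ∘ suc))
                         (prefix-tail≤prefix b-anti (count (s ∘ suc)))

≤prefix : ∀ {k} (d : Fin k → ℕ) {i c} → toℕ i ℕ.< c → d i ℕ.≤ prefix d c
≤prefix d {i} {c} i<c =
  subst (ℕ._≤ prefix d c) (cong (λ e → if e then d i else 0) (Equivalence.to T-≡ (ℕₚ.≤⇒≤ᵇ i<c)))
        (single≤sumℕ (λ j → if suc (toℕ j) ℕ.≤ᵇ c then d j else 0) i)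

piAux≤ : ∀ {m} (b : Fin m → ℕ) t c fuel j → j ℕ.≤ c → c ℕ.< j ℕ.+ fuel → t ℕ.≤ prefix b c →
  piAux b t fuel j ℕ.≤ c
piAux≤ b t c zero j j≤c c<j+0 t≤ = contradiction (ℕₚ.<-≤-trans c<j+0 (ℕₚ.≤-reflexive (ℕₚ.+-identityʳ j)))
                                                 (ℕₚ.≤⇒≯ j≤c)
piAux≤ b t c (suc fuel) j j≤c c<j+1+fuel t≤ with t ℕ.≤ᵇ prefix b j in found
... | true  = j≤c
... | false with j ℕₚ.≟ c
...   | yes refl = ⊥-elim (subst T found (ℕₚ.≤⇒≤ᵇ t≤))
...   | no  j≢c  = piAux≤ b t c fuel (suc j) (ℕₚ.≤∧≢⇒< j≤c j≢c)
                     (ℕₚ.<-≤-trans c<j+1+fuel (ℕₚ.≤-reflexive (ℕₚ.+-suc j fuel))) t≤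

π≤ : ∀ {m} (b : Fin m → ℕ) {t} c → 0 ℕ.< t → t ℕ.≤ prefix b c → c ℕ.≤ m → π b t ℕ.≤ c
π≤ b zero    0<t t≤ _   = contradiction (ℕₚ.<-≤-trans 0<t (ℕₚ.≤-trans t≤ (ℕₚ.≤-reflexive (prefix-zero b))))
                                        (ℕₚ.<-irrefl refl)
π≤ b (suc c) 0<t t≤ c≤m = piAux≤ b _ (suc c) _ 1 (ℕ.s≤s ℕ.z≤n) (ℕ.s≤s c≤m) t≤

isPos : ℚ → Bool
isPos q = does (0ℚ <? q)

support : ∀ {n m} → (Fin n → Fin m → ℚ) → Fin n → ℕ
support x i = count (λ j → isPos (x i j))

touched : ∀ {n m} → (Fin n → Bool) → (Fin n → Fin m → ℚ) → Fin m → Bool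
touched R x j = anyFin (λ i → R i ∧ isPos (x i j))

count-touched≤ : ∀ {n m} (R : Fin n → Bool) (x : Fin n → Fin m → ℚ) →
  count (touched R x) ℕ.≤ sumℕ (λ i → if R i then support x i else 0)
count-touched≤ R x = ℕₚ.≤-trans (count-anyFin≤ (λ i j → R i ∧ isPos (x i j)))
                                (ℕₚ.≤-reflexive (sumℕ-cong λ i → count-∧ (R i) (λ j → isPos (x i j))))

selected≤touched : ∀ {n m} {x : Fin n → Fin m → ℚ} → (∀ i j → 0ℚ ≤ x i j) → ∀ R i j →
  (if R i then x i j else 0ℚ) ≤ (if touched R x j then x i j else 0ℚ)
selected≤touched {x = x} x≥0 R i j with R i in Rᵢ | touched R x j in touchedⱼ
... | false | false = ℚₚ.≤-refl
... | false | true  = x≥0 i j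
... | true  | true  = ℚₚ.≤-refl
... | true  | false with 0ℚ <? x i j in xᵢⱼ>0?
...   | yes _    = contradiction (trans (sym (anyFin-intro _ i (cong₂ _∧_ Rᵢ (cong does xᵢⱼ>0?)))) touchedⱼ)
                                 λ ()
...   | no  xᵢⱼ≯0 = ℚₚ.≮⇒≥ xᵢⱼ≯0

selectedRows≤touchedColumns : ∀ {n m} {a : Fin n → ℕ} {b : Fin m → ℕ} {x} → Feasible a b x →
  ∀ R → sumℕ (λ i → if R i then a i else 0) ℕ.≤ sumℕ (λ j → if touched R x j then b j else 0)
selectedRows≤touchedColumns {n} {m} {a} {b} {x} (x≥0 , rows , columns) R = ℕ→ℚ-cancel-≤ (begin
  ℕ→ℚ (sumℕ (λ i → if R i then a i else 0))
    ≡⟨ ℕ→ℚ-selectedSum R a (λ i → sumℚ (x i)) (sym ∘ rows) ⟩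
  sumℚ (λ i → if R i then sumℚ (x i) else 0ℚ)
    ≡⟨ sumℚ-cong (λ i → sumℚ-if (R i) (x i)) ⟨
  sumℚ (λ i → sumℚ (λ j → if R i then x i j else 0ℚ))
    ≤⟨ sumℚ-mono-≤ (λ i → sumℚ-mono-≤ (selected≤touched x≥0 R i)) ⟩
  sumℚ (λ i → sumℚ (λ j → if s j then x i j else 0ℚ))
    ≡⟨ sumℚ-comm (λ i j → if s j then x i j else 0ℚ) ⟩
  sumℚ (λ j → sumℚ (λ i → if s j then x i j else 0ℚ))
    ≡⟨ sumℚ-cong (λ j → sumℚ-if (s j) (λ i → x i j)) ⟩
  sumℚ (λ j → if s j then sumℚ (λ i → x i j) else 0ℚ)
    ≡⟨ ℕ→ℚ-selectedSum s b (λ j → sumℚ (λ i → x i j)) (sym ∘ columns) ⟨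
  ℕ→ℚ (sumℕ (λ j → if s j then b j else 0)) ∎)
  where
  open ℚₚ.≤-Reasoning
  s : Fin m → Bool
  s = touched R x

π-prefix≤prefix-support : ∀ {n m} {a : Fin n → ℕ} {b : Fin m → ℕ} {x} → Feasible a b x →
  (∀ i → a i > 0) → Decreasing b → ∀ i →
  π b (prefix a (suc (toℕ i))) ℕ.≤ prefix (support x) (suc (toℕ i))
π-prefix≤prefix-support {a = a} {b} {x} feasible a>0 b-anti i = begin
  π b (prefix a (suc (toℕ i)))
    ≤⟨ π≤ b (count (touched R x)) (ℕₚ.<-≤-trans (a>0 i) (≤prefix a ℕₚ.≤-refl))
           (ℕₚ.≤-trans (selectedRows≤touchedColumns feasible R) (selectedSum≤prefix-count b-anti (touched R x)))
           (count≤ (touched R x)) ⟩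
  count (touched R x)
    ≤⟨ count-touched≤ R x ⟩
  prefix (support x) (suc (toℕ i)) ∎
  where
  open ℕₚ.≤-Reasoning
  R : Fin _ → Bool
  R k = suc (toℕ k) ℕ.≤ᵇ suc (toℕ i)

cost≡sum-support : ∀ {n m} (f : Fin n → ℚ) (x : Fin n → Fin m → ℚ) →
  cost f x ≡ sumℚ (λ i → f i * ℕ→ℚ (support x i))
cost≡sum-support f x = sumℚ-cong λ i → sumℚ-indicator (λ j → isPos (x i j)) (f i)

lemma4p2 : (n m : ℕ) (a : Fin n → ℕ) (b : Fin m → ℕ) (f : Fin n → ℚ) →
    (∀ i → a i > 0) → (∀ j → b j > 0) → (∀ i → 0ℚ ≤ f i) →
    (∀ i i′ → i Data.Fin.≤ i′ → f i′ ≤ f i) →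
    (∀ j j′ → j Data.Fin.≤ j′ → b j′ Data.Nat.≤ b j) →
    sumℕ a ≡ sumℕ b →
    (x : Fin n → Fin m → ℚ) → Feasible a b x →
    lowerBound a b f ≤ cost f x
lemma4p2 n m a b f a>0 _ f≥0 f-anti b-anti _ x feasible = begin
  lowerBound a b f
    ≤⟨ sumℚ-mono-≤ termwise ⟩
  sumℚ {n} (λ i → (G (toℕ i) - G (suc (toℕ i))) * ℕ→ℚ (prefix (support x) (suc (toℕ i))))
    ≡⟨ summation-by-parts G (support x) (fExt-end f) ⟩
  sumℚ (λ i → G (toℕ i) * ℕ→ℚ (support x i))
    ≡⟨ sumℚ-cong (λ i → cong (_* ℕ→ℚ (support x i)) (fExt-toℕ f i)) ⟩
  sumℚ (λ i → f i * ℕ→ℚ (support x i))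
    ≡⟨ cost≡sum-support f x ⟨
  cost f x ∎
  where
  open ℚₚ.≤-Reasoning
  G : ℕ → ℚ
  G = fExt f
  termwise : ∀ i → (f i - G (suc (toℕ i))) * ℕ→ℚ (π b (prefix a (suc (toℕ i))))
                 ≤ (G (toℕ i) - G (suc (toℕ i))) * ℕ→ℚ (prefix (support x) (suc (toℕ i)))
  termwise i rewrite fExt-toℕ f i =
    ℚₚ.*-monoˡ-≤-nonNeg (f i - G (suc (toℕ i))) {{nonNegative (p≤q⇒0≤q-p (fExt-suc≤ f f≥0 f-anti i))}}
      (ℕ→ℚ-mono-≤ (π-prefix≤prefix-support feasible a>0 b-anti i))
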